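{- Let $a_0,a_1$ be elements of a commutative ring with unity and let $k\ge1$. Then for all $n\geqslant1$, \[ \operatorname{per}\bigl((a_0I_n+a_1P_n)\otimes J_k\bigr)=(k!)^n\sum_{l=0}^k\binom kl^n\bigl(a_0^{k-l}a_1^l\bigr)^n. \]
   Context: $P_n=(c_{i,j})_{1\le i,j\le n}$ with $c_{i,j}=1$ if $j-i\equiv1\pmod n$ and $0$ otherwise. $J_k$ is the $k\times k$ all-ones matrix, $\otimes$ the Kronecker product, $\operatorname{per}$ the permanent. -}

module Defs where

open import Level using (Level)
open import Algebra.Bundles using (CommutativeRing; Semiring)
open import Data.Nat as ℕ using (ℕ; zero; suc; _%_; _!; _≡ᵇ_)
open import Data.Nat.Combinatorics using (_C_)
open import Data.Fin as Fin using (Fin; toℕ; remQuot)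
open import Data.Fin.Properties using (all?) renaming (_≟_ to _≟ᶠ_)
open import Data.Product using (_,_)
open import Data.List as List using (List; []; _∷_; filter; concatMap; map; allFin; foldr)
open import Relation.Nullary using (Dec; yes; no)
open import Relation.Nullary.Decidable using (_→-dec_)
open import Relation.Binary.PropositionalEquality using (_≡_)

allFuns : (m n : ℕ) → List (Fin m → Fin n)
allFuns zero    n = (λ ()) ∷ []
allFuns (suc m) n =
  concatMap (λ i → map (λ f → λ { Fin.zero → i ; (Fin.suc x) → f x }) (allFuns m n))
            (List.allFin n)

IsInjective : ∀ {n} → (Fin n → Fin n) → Set
IsInjective {n} σ = (i j : Fin n) → σ i ≡ σ j → i ≡ j

injective? : ∀ {n} (σ : Fin n → Fin n) → Dec (IsInjective σ)
injective? σ = all? (λ i → all? (λ j → (σ i ≟ᶠ σ j) →-dec (i ≟ᶠ j)))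

permutations : (n : ℕ) → List (Fin n → Fin n)
permutations n = filter injective? (allFuns n n)

module Ops {c ℓ : Level} (R : CommutativeRing c ℓ) where
  open CommutativeRing R public
  open import Algebra.Definitions.RawSemiring (Semiring.rawSemiring semiring) public using (_^_)
  open import Algebra.Definitions.RawSemiring (Semiring.rawSemiring semiring) using (_×_)

  ι : ℕ → Carrier
  ι m = m × 1#

  Matrix : ℕ → Set c
  Matrix n = Fin n → Fin n → Carrier

  Σ[<_]_ : (n : ℕ) → (Fin n → Carrier) → Carrier
  Σ[< n ] f = foldr (λ i acc → f i + acc) 0# (allFin n)

  Π[<_]_ : (n : ℕ) → (Fin n → Carrier) → Carrier
  Π[< n ] f = foldr (λ i acc → f i * acc) 1# (allFin n)

  per : ∀ {n} → Matrix n → Carrier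
  per {n} A = foldr (λ σ acc → (Π[< n ] λ i → A i (σ i)) + acc) 0# (permutations n)

  I : (n : ℕ) → Matrix n
  I n i j = if? i j
    where
    if? : Fin n → Fin n → Carrier
    if? i j with i ≟ᶠ j
    ... | yes _ = 1#
    ... | no  _ = 0#

  -- P_n : c_{ij} = 1 iff j - i ≡ 1 (mod n)   (0-indexed: toℕ j = (toℕ i + 1) mod n)
  P : (n : ℕ) → Matrix n
  P (suc m) i j with toℕ j ℕ.≟ ((toℕ i ℕ.+ 1) % suc m)
  ... | yes _ = 1#
  ... | no  _ = 0#

  J : (k : ℕ) → Matrix k
  J k _ _ = 1#

  -- Kronecker product, index (i , p) ↦ i * k + p
  _⊗_ : ∀ {n k} → Matrix n → Matrix k → Matrix (n ℕ.* k)
  _⊗_ {n} {k} A B x y with remQuot {n} k x | remQuot {n} k y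
  ... | i , p | j , q = A i j * B p q

  _⊕_ : ∀ {n} → Matrix n → Matrix n → Matrix n
  (A ⊕ B) i j = A i j + B i j

  _·_ : ∀ {n} → Carrier → Matrix n → Matrix n
  (a · A) i j = a * A i j

module Submission where

open import Defs
open import Level using (Level)
open import Algebra.Bundles using (CommutativeRing)
open import Data.Nat using (ℕ; suc; _≥_; _!; _∸_)
open import Data.Nat.Combinatorics using (_C_)
open import Data.Fin using (toℕ)

open import Data.Nat as ℕ using (zero; _≤_; _<_; s≤s)
import Data.Nat.Properties as ℕP
open import Data.Nat.Combinatorics using (nCk+nC[k+1]≡[n+1]C[k+1]; k>n⇒nCk≡0)
open import Data.Fin as F using (Fin; _↑ˡ_; _↑ʳ_)
import Data.Fin.Properties as FP
import Data.Nat.DivMod as ℕDM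
open import Data.List as List using (List; []; _∷_; _++_; replicate)
import Data.List.Properties as ListP
import Data.Vec.Functional as Vector
open import Data.Bool using (Bool; true; false; if_then_else_; not; _∧_; _∨_)
import Data.Bool.Properties as BoolP
open import Relation.Nullary.Decidable using (dec-true; dec-false)
open import Data.Product using (_×_; _,_; proj₁; proj₂)
open import Function using (_∘_; id)
open import Function.Definitions using (Injective)
open import Relation.Nullary using (Dec; yes; no; does; contradiction)
open import Relation.Binary.PropositionalEquality as ≡ using (_≡_; _≢_)
import Algebra.Properties.CommutativeMonoid.Sum as CommutativeMonoidSum

-- Every entry of A ⊗ J_k depends only on the blocks of its row and column, so
-- a column is determined, up to equal copies, by its block (its "type"), and
-- there are k columns of each type.  Expanding the permanent along the rows,
-- each row is sent to a still-free column; grouping the free columns by type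
-- gives `perMult`, the permanent of a matrix with column multiplicities, whose
-- expansion carries a capacity vector counting the free columns of each type
-- (per-⊗J).
--
-- Row i of a₀ Iₙ + a₁ Pₙ is a₀·eᵢ + a₁·e₍ᵢ₊₁₎.  A block of k equal rows
-- x·eᵢ + y·eⱼ expands, by Pascal's rule, into a binomial sum over the number l
-- of its rows sent to type j (block).  For n ≥ 2 the first block opens the
-- cycle 0 → 1 → ⋯ → n-1 → 0, and the other blocks form a chain along the path
-- 1, …, n-1, 0 of distinct types, in which the capacities force every block to
-- use the same l (chain); each block then contributes X l = C(k,l) a₀^(k-l)
-- a₁^l k!.  For n = 1 there is a single type and the binomial theorem yields
-- the same sum.  Either way the permanent is Σₗ (X l)ⁿ, which is the right-hand
-- side of the theorem.

module Combinatorics where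
  open import Data.Nat using (_+_; _*_)
  open ≡ using (refl; cong)

  δℕ : ∀ {n} → Fin n → Fin n → ℕ
  δℕ F.zero    F.zero    = 1
  δℕ F.zero    (F.suc _) = 0
  δℕ (F.suc _) F.zero    = 0
  δℕ (F.suc i) (F.suc j) = δℕ i j

  δℕ-refl : ∀ {n} (i : Fin n) → δℕ i i ≡ 1
  δℕ-refl F.zero    = refl
  δℕ-refl (F.suc i) = δℕ-refl i

  δℕ-≢ : ∀ {n} {i j : Fin n} → i ≢ j → δℕ i j ≡ 0
  δℕ-≢ {i = F.zero}  {F.zero}  i≢j = contradiction refl i≢j
  δℕ-≢ {i = F.zero}  {F.suc j} _   = refl
  δℕ-≢ {i = F.suc i} {F.zero}  _   = refl
  δℕ-≢ {i = F.suc i} {F.suc j} i≢j = δℕ-≢ (i≢j ∘ cong F.suc)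

  -- The falling factorial a ↓ b = a (a-1) ⋯ (a-b+1): the number of ways to
  -- send b distinguishable rows injectively into a available columns.
  infixl 8 _↓_
  _↓_ : ℕ → ℕ → ℕ
  a ↓ zero  = 1
  a ↓ suc b = a * ((a ∸ 1) ↓ b)

  ↓-vanishes : ∀ {a b} → a < b → a ↓ b ≡ 0
  ↓-vanishes {zero}  {suc b} _         = refl
  ↓-vanishes {suc a} {suc b} (s≤s a<b) =
    ≡.trans (cong (suc a *_) (↓-vanishes a<b)) (ℕP.*-zeroʳ (suc a))

  ↓-split : ∀ {a b} → b ≤ a → a ↓ b * (a ∸ b) ! ≡ a !
  ↓-split {a}     {zero}  _         = ℕP.+-identityʳ (a !)
  ↓-split {suc a} {suc b} (s≤s b≤a) =
    ≡.trans (ℕP.*-assoc (suc a) (a ↓ b) ((a ∸ b) !)) (cong (suc a *_) (↓-split b≤a))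

  ↓-self : ∀ a → a ↓ a ≡ a !
  ↓-self a = begin
    a ↓ a                ≡⟨ ℕP.*-identityʳ (a ↓ a) ⟨
    a ↓ a * 1            ≡⟨ cong (λ d → a ↓ a * d !) (ℕP.n∸n≡0 a) ⟨
    a ↓ a * (a ∸ a) !    ≡⟨ ↓-split (ℕP.≤-refl {a}) ⟩
    a !                  ∎
    where open ≡.≡-Reasoning

  -- A capacity records, for each column type, how many columns are available.
  Capacity : ℕ → Set
  Capacity n = Fin n → ℕ

  use : ∀ {n} → Capacity n → Fin n → ℕ → Capacity n
  use c i s b = c b ∸ δℕ i b * s

  module _ {n : ℕ} (c : Capacity n) where

    use-at : ∀ i s → use c i s i ≡ c i ∸ s
    use-at i s = cong (c i ∸_) (≡.trans (cong (_* s) (δℕ-refl i)) (ℕP.*-identityˡ s))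

    use-away : ∀ {i b} s → i ≢ b → use c i s b ≡ c b
    use-away {i} {b} s i≢b = cong (λ d → c b ∸ d * s) (δℕ-≢ i≢b)

    use-none : ∀ i b → use c i 0 b ≡ c b
    use-none i b = cong (c b ∸_) (ℕP.*-zeroʳ (δℕ i b))

    use-use : ∀ i s t b → use (use c i s) i t b ≡ use c i (s + t) b
    use-use i s t b = ≡.trans (ℕP.∸-+-assoc (c b) (δℕ i b * s) (δℕ i b * t))
                              (cong (c b ∸_) (≡.sym (ℕP.*-distribˡ-+ (δℕ i b) s t)))

    use-comm : ∀ i s j t b → use (use c i s) j t b ≡ use (use c j t) i s b
    use-comm i s j t b = begin
      (c b ∸ x) ∸ y  ≡⟨ ℕP.∸-+-assoc (c b) x y ⟩
      c b ∸ (x + y)  ≡⟨ cong (c b ∸_) (ℕP.+-comm x y) ⟩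
      c b ∸ (y + x)  ≡⟨ ℕP.∸-+-assoc (c b) y x ⟨
      (c b ∸ y) ∸ x  ∎
      where
      open ≡.≡-Reasoning
      x = δℕ i b * s
      y = δℕ j b * t

  use-cong : ∀ {n} {c c′ : Capacity n} → (∀ b → c b ≡ c′ b) → ∀ i s b → use c i s b ≡ use c′ i s b
  use-cong c≗c′ i s b = cong (_∸ δℕ i b * s) (c≗c′ b)

  module ℕΣ = CommutativeMonoidSum ℕP.+-0-commutativeMonoid

  sumℕ-↑ : ∀ k {m} (h : Fin (k + m) → ℕ) → ℕΣ.sum h ≡ ℕΣ.sum (h ∘ (_↑ˡ m)) + ℕΣ.sum (h ∘ (k ↑ʳ_))
  sumℕ-↑ zero    h = refl
  sumℕ-↑ (suc k) h = ≡.trans (cong (h F.zero +_) (sumℕ-↑ k (h ∘ F.suc)))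
                             (≡.sym (ℕP.+-assoc (h F.zero) _ _))

  sumℕ-const : ∀ k a → ℕΣ.sum {k} (λ _ → a) ≡ k * a
  sumℕ-const zero    a = refl
  sumℕ-const (suc k) a = cong (a +_) (sumℕ-const k a)

  Avoids : ∀ {m N} → (Fin N → Bool) → (Fin m → Fin N) → Set
  Avoids U f = ∀ x → U (f x) ≡ false

  mark : ∀ {N} → (Fin N → Bool) → Fin N → Fin N → Bool
  mark U y z = U z ∨ does (z FP.≟ y)

  fresh : ∀ {m N} → (Fin N → Bool) → (Fin m → Fin N) → Bool
  fresh {zero}  U f = true
  fresh {suc m} U f = not (U (f F.zero)) ∧ fresh (mark U (f F.zero)) (f ∘ F.suc)

  fresh-sound : ∀ {m N} (U : Fin N → Bool) (f : Fin m → Fin N) → fresh U f ≡ true → Injective _≡_ _≡_ f × Avoids U f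
  fresh-sound {zero}  U f _ = (λ { {()} }) , (λ ())
  fresh-sound {suc m} U f ok with U (f F.zero) in U[f0]
  ... | false = injective , avoids
    where
    tail-ok : Injective _≡_ _≡_ (f ∘ F.suc) × Avoids (mark U (f F.zero)) (f ∘ F.suc)
    tail-ok = fresh-sound (mark U (f F.zero)) (f ∘ F.suc) ok
    avoids-mark : ∀ x → U (f (F.suc x)) ≡ false × does (f (F.suc x) FP.≟ f F.zero) ≡ false
    avoids-mark x = BoolP.∨-conicalˡ _ _ (proj₂ tail-ok x) , BoolP.∨-conicalʳ _ _ (proj₂ tail-ok x)
    new : ∀ x → f (F.suc x) ≢ f F.zero
    new x eq = contradiction (≡.trans (≡.sym (dec-true (f (F.suc x) FP.≟ f F.zero) eq)) (proj₂ (avoids-mark x))) λ ()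
    injective : Injective _≡_ _≡_ f
    injective {F.zero}  {F.zero}  _  = ≡.refl
    injective {F.zero}  {F.suc j} eq = contradiction (≡.sym eq) (new j)
    injective {F.suc i} {F.zero}  eq = contradiction eq (new i)
    injective {F.suc i} {F.suc j} eq = ≡.cong F.suc (proj₁ tail-ok eq)
    avoids : Avoids U f
    avoids F.zero    = U[f0]
    avoids (F.suc x) = proj₁ (avoids-mark x)

  fresh-complete : ∀ {m N} (U : Fin N → Bool) (f : Fin m → Fin N) → Injective _≡_ _≡_ f → Avoids U f → fresh U f ≡ true
  fresh-complete {zero}  U f _         _      = ≡.refl
  fresh-complete {suc m} U f injective avoids rewrite avoids F.zero =
    fresh-complete (mark U (f F.zero)) (f ∘ F.suc) (FP.suc-injective ∘ injective) avoids-mark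
    where
    avoids-mark : Avoids (mark U (f F.zero)) (f ∘ F.suc)
    avoids-mark x rewrite avoids (F.suc x) =
      dec-false (f (F.suc x) FP.≟ f F.zero) (λ eq → 0≢suc (injective eq))
      where
      0≢suc : F.suc x ≢ F.zero
      0≢suc ()

  injective?≡fresh : ∀ {N} (σ : Fin N → Fin N) → does (injective? σ) ≡ fresh (λ _ → false) σ
  injective?≡fresh σ with fresh (λ _ → false) σ in ok
  ... | true  = dec-true (injective? σ) (λ i j → proj₁ (fresh-sound _ σ ok))
  ... | false = dec-false (injective? σ) λ inj →
                  contradiction (≡.trans (≡.sym ok) (fresh-complete _ σ (inj _ _) (λ _ → ≡.refl))) λ ()

  -- The number of columns of type b outside U, when column y has type β y.
  available : ∀ {N n} → (Fin N → Fin n) → (Fin N → Bool) → Capacity n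
  available β U b = ℕΣ.sum (λ y → if U y then 0 else δℕ (β y) b)

  available-mark : ∀ {N n} (β : Fin N → Fin n) U y → U y ≡ false →
    ∀ b → available β (mark U y) b ≡ use (available β U) (β y) 1 b
  available-mark {suc N} β U y U[y] b = begin
    ℕΣ.sum h′                                  ≡⟨ ℕΣ.sum-remove {i = y} h′ ⟩
    h′ y + ℕΣ.sum (Vector.removeAt h′ y)     ≡⟨ ≡.cong₂ _+_ h′[y] (ℕΣ.sum-cong-≗ elsewhere) ⟩
    ℕΣ.sum (Vector.removeAt h y)               ≡⟨ ℕP.m+n∸m≡n (h y) _ ⟨
    h y + ℕΣ.sum (Vector.removeAt h y) ∸ h y ≡⟨ ≡.cong₂ _∸_ (ℕΣ.sum-remove {i = y} h) (≡.sym h[y]) ⟨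
    ℕΣ.sum h ∸ δℕ (β y) b * 1                ∎
    where
    open ≡.≡-Reasoning
    h h′ : Fin (suc N) → ℕ
    h  z = if U z then 0 else δℕ (β z) b
    h′ z = if mark U y z then 0 else δℕ (β z) b
    h[y] : h y ≡ δℕ (β y) b * 1
    h[y] = ≡.trans (≡.cong (λ u → if u then 0 else δℕ (β y) b) U[y]) (≡.sym (ℕP.*-identityʳ _))
    h′[y] : h′ y ≡ 0
    h′[y] = ≡.cong (λ u → if u then 0 else δℕ (β y) b)
                   (≡.trans (≡.cong (U y ∨_) (dec-true (y FP.≟ y) ≡.refl)) (BoolP.∨-zeroʳ (U y)))
    elsewhere : ∀ j → h′ (F.punchIn y j) ≡ h (F.punchIn y j)
    elsewhere j = ≡.cong (λ u → if u then 0 else δℕ (β (F.punchIn y j)) b)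
      (≡.trans (≡.cong (U (F.punchIn y j) ∨_) (dec-false (F.punchIn y j FP.≟ y) (FP.punchInᵢ≢i y j)))
               (BoolP.∨-identityʳ _))

  repeatRows : ∀ {a} {A : Set a} k n → (Fin n → A) → List A
  repeatRows k zero    W = []
  repeatRows k (suc n) W = replicate k (W F.zero) ++ repeatRows k n (W ∘ F.suc)

  quotient-↑ˡ : ∀ {n k} (j : Fin k) → F.quotient {suc n} k (j ↑ˡ (n * k)) ≡ F.zero
  quotient-↑ˡ {n} {k} j rewrite FP.splitAt-↑ˡ k j (n * k) = ≡.refl

  quotient-↑ʳ : ∀ {n k} (x : Fin (n * k)) → F.quotient {suc n} k (k ↑ʳ x) ≡ F.suc (F.quotient {n} k x)
  quotient-↑ʳ {n} {k} x rewrite FP.splitAt-↑ʳ k (n * k) x = ≡.refl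

  tabulate-↑ : ∀ {a} {A : Set a} k m (f : Fin (k + m) → A) →
    List.tabulate f ≡ List.tabulate (f ∘ (_↑ˡ m)) ++ List.tabulate (f ∘ (k ↑ʳ_))
  tabulate-↑ zero    m f = ≡.refl
  tabulate-↑ (suc k) m f = ≡.cong (f F.zero ∷_) (tabulate-↑ k m (f ∘ F.suc))

  tabulate-const : ∀ {a} {A : Set a} k (v : A) → List.tabulate {n = k} (λ _ → v) ≡ replicate k v
  tabulate-const zero    v = ≡.refl
  tabulate-const (suc k) v = ≡.cong (v ∷_) (tabulate-const k v)

  tabulate-quotient : ∀ {a} {A : Set a} k n (W : Fin n → A) →
    List.tabulate (W ∘ F.quotient {n} k) ≡ repeatRows k n W
  tabulate-quotient k zero    W = ≡.refl
  tabulate-quotient k (suc n) W = ≡.trans (tabulate-↑ k (n * k) _) (≡.cong₂ _++_ first-block other-blocks)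
    where
    first-block : List.tabulate (W ∘ F.quotient {suc n} k ∘ (_↑ˡ n * k)) ≡ replicate k (W F.zero)
    first-block = ≡.trans (ListP.tabulate-cong (≡.cong W ∘ quotient-↑ˡ)) (tabulate-const k (W F.zero))
    other-blocks : List.tabulate (W ∘ F.quotient {suc n} k ∘ (k ↑ʳ_)) ≡ repeatRows k n (W ∘ F.suc)
    other-blocks = ≡.trans (ListP.tabulate-cong (≡.cong W ∘ quotient-↑ʳ)) (tabulate-quotient k n (W ∘ F.suc))

  available-quotient : ∀ k n (b : Fin n) → available (F.quotient {n} k) (λ _ → false) b ≡ k
  available-quotient k (suc n) b = begin
    available (F.quotient {suc n} k) (λ _ → false) b
      ≡⟨ sumℕ-↑ k {n * k} _ ⟩
    ℕΣ.sum {k} (λ j → δℕ (F.quotient {suc n} k (j ↑ˡ n * k)) b)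
      + ℕΣ.sum {n * k} (λ x → δℕ (F.quotient {suc n} k (k ↑ʳ x)) b)
      ≡⟨ ≡.cong₂ _+_ (ℕΣ.sum-cong-≗ {k} (λ j → ≡.cong (λ i → δℕ i b) (quotient-↑ˡ {n} {k} j)))
                       (ℕΣ.sum-cong-≗ {n * k} (λ x → ≡.cong (λ i → δℕ i b) (quotient-↑ʳ {n} {k} x))) ⟩
    ℕΣ.sum {k} (λ _ → δℕ F.zero b) + ℕΣ.sum {n * k} (λ x → δℕ (F.suc (F.quotient {n} k x)) b)
      ≡⟨ count b ⟩
    k ∎
    where
    open ≡.≡-Reasoning
    count : ∀ b → ℕΣ.sum {k} (λ _ → δℕ F.zero b) + ℕΣ.sum {n * k} (λ x → δℕ (F.suc (F.quotient {n} k x)) b) ≡ k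
    count F.zero    = ≡.trans (≡.cong₂ _+_ (sumℕ-const k 1) (sumℕ-const (n * k) 0))
                              (≡.trans (≡.cong₂ _+_ (ℕP.*-identityʳ k) (ℕP.*-zeroʳ (n * k))) (ℕP.+-identityʳ k))
    count (F.suc b) = ≡.trans (≡.cong (_+ ℕΣ.sum {n * k} (λ x → δℕ (F.quotient {n} k x) b))
                                      (≡.trans (sumℕ-const k 0) (ℕP.*-zeroʳ k)))
                              (available-quotient k n b)

  -- The successor of σ t along the path σ 0, σ 1, …, σ r, z.
  next : ∀ {r n} → (Fin (suc r) → Fin n) → Fin n → Fin (suc r) → Fin n
  next {zero}  σ z F.zero    = z
  next {suc r} σ z F.zero    = σ (F.suc F.zero)
  next {suc r} σ z (F.suc t) = next (σ ∘ F.suc) z t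

  next-inject₁ : ∀ {r n} (σ : Fin (suc r) → Fin n) z (t : Fin r) → next σ z (F.inject₁ t) ≡ σ (F.suc t)
  next-inject₁ {suc r} σ z F.zero    = ≡.refl
  next-inject₁ {suc r} σ z (F.suc t) = next-inject₁ (σ ∘ F.suc) z t

  next-last : ∀ {r n} (σ : Fin (suc r) → Fin n) z → next σ z (F.fromℕ r) ≡ z
  next-last {zero}  σ z = ≡.refl
  next-last {suc r} σ z = next-last (σ ∘ F.suc) z

  -- In the n-cycle 0 → 1 → ⋯ → n-1 → 0, the path 1, 2, …, n-1, 0 is
  -- followed by the rows 1, …, n-1 of Pₙ.
  cycle-successor : ∀ r (t : Fin (suc r)) → toℕ (next F.suc F.zero t) ≡ (toℕ (F.suc t) + 1) ℕ.% suc (suc r)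
  cycle-successor r t with toℕ t ℕ.≟ r
  ... | yes t≡r = begin
    toℕ (next F.suc F.zero t)               ≡⟨ ≡.cong (toℕ ∘ next F.suc F.zero) t≡last ⟩
    toℕ (next F.suc F.zero (F.fromℕ r))     ≡⟨ ≡.cong toℕ (next-last F.suc F.zero) ⟩
    0                                        ≡⟨ ℕDM.n%n≡0 (suc (suc r)) ⟨
    suc (suc r) ℕ.% suc (suc r)              ≡⟨ ≡.cong (ℕ._% suc (suc r)) (ℕP.+-comm 1 (suc r)) ⟩
    (suc r + 1) ℕ.% suc (suc r)            ≡⟨ ≡.cong (λ a → (suc a + 1) ℕ.% suc (suc r)) t≡r ⟨
    (toℕ (F.suc t) + 1) ℕ.% suc (suc r)   ∎
    where
    open ≡.≡-Reasoning
    t≡last : t ≡ F.fromℕ r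
    t≡last = FP.toℕ-injective (≡.trans t≡r (≡.sym (FP.toℕ-fromℕ r)))
  ... | no  t≢r = begin
    toℕ (next F.suc F.zero t)                          ≡⟨ ≡.cong (toℕ ∘ next F.suc F.zero) t≡t′ ⟩
    toℕ (next F.suc F.zero (F.inject₁ t′))             ≡⟨ ≡.cong toℕ (next-inject₁ F.suc F.zero t′) ⟩
    suc (suc (toℕ t′))                                 ≡⟨ ℕDM.m<n⇒m%n≡m (s≤s (s≤s (FP.toℕ<n t′))) ⟨
    suc (suc (toℕ t′)) ℕ.% suc (suc r)                 ≡⟨ ≡.cong (λ a → suc (suc a) ℕ.% suc (suc r)) t′≡t ⟩
    suc (suc (toℕ t)) ℕ.% suc (suc r)                  ≡⟨ ≡.cong (ℕ._% suc (suc r)) (ℕP.+-comm 1 (suc (toℕ t))) ⟩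
    (toℕ (F.suc t) + 1) ℕ.% suc (suc r)              ∎
    where
    open ≡.≡-Reasoning
    t′ : Fin r
    t′ = F.lower₁ t (t≢r ∘ ≡.sym)
    t≡t′ : t ≡ F.inject₁ t′
    t≡t′ = ≡.sym (FP.inject₁-lower₁ t (t≢r ∘ ≡.sym))
    t′≡t : toℕ t′ ≡ toℕ t
    t′≡t = FP.toℕ-lower₁ t (t≢r ∘ ≡.sym)

open Combinatorics

module Permanents {c ℓ : Level} (R : CommutativeRing c ℓ) where

  open Ops R
  open import Algebra.Properties.Semiring.Sum semiring
    using (sum; sum-syntax; sum-cong-≋; sum-replicate-zero; sum-remove; sum-init-last;
           ∑-distrib-+; ∑-comm; *-distribˡ-sum; *-distribʳ-sum)
  open import Algebra.Properties.Semiring.Mult semiring using (×1-homo-*; ×-homo-+; ×-assoc-*; ×-congʳ) renaming (_×_ to _⨯_)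
  open import Algebra.Properties.Semiring.Exp semiring using (^-congˡ)
  import Algebra.Properties.CommutativeSemiring.Binomial commutativeSemiring as Binomial
  open import Algebra.Properties.CommutativeSemiring.Exp commutativeSemiring using (^-distrib-*)
  open import Algebra.Properties.CommutativeSemigroup *-commutativeSemigroup using (x∙yz≈y∙xz; xy∙z≈y∙xz)
  open import Algebra.Properties.CommutativeSemigroup +-commutativeSemigroup using () renaming (x∙yz≈xz∙y to x+[y+z]≈[x+z]+y)
  open import Algebra.Solver.CommutativeMonoid *-commutativeMonoid using (solve; _⊜_) renaming (_⊕_ to _·′_; id to ε′)
  open import Relation.Binary.Reasoning.Setoid setoid

  ι-+ : ∀ m n → ι (m ℕ.+ n) ≈ ι m + ι n
  ι-+ m n = ×-homo-+ 1# m n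

  ι-* : ∀ m n → ι (m ℕ.* n) ≈ ι m * ι n
  ι-* = ×1-homo-*

  ι-1 : ι 1 ≈ 1#
  ι-1 = +-identityʳ 1#

  ι-sum : ∀ {N} (h : Fin N → ℕ) → ι (ℕΣ.sum h) ≈ sum (ι ∘ h)
  ι-sum {zero}  h = refl
  ι-sum {suc N} h = trans (ι-+ (h F.zero) _) (+-congˡ (ι-sum (h ∘ F.suc)))

  δ : ∀ {n} → Fin n → Fin n → Carrier
  δ i j = ι (δℕ i j)

  prod : ∀ {n} → (Fin n → Carrier) → Carrier
  prod = Vector.foldr _*_ 1#

  foldr-tabulate : ∀ {a} {A : Set a} (_⊙_ : Carrier → Carrier → Carrier) e n (g : Fin n → A) (h : A → Carrier) →
    List.foldr (λ x acc → h x ⊙ acc) e (List.tabulate g) ≡ Vector.foldr _⊙_ e (h ∘ g)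
  foldr-tabulate _⊙_ e zero    g h = ≡.refl
  foldr-tabulate _⊙_ e (suc n) g h = ≡.cong (h (g F.zero) ⊙_) (foldr-tabulate _⊙_ e n (g ∘ F.suc) h)

  Σ[<]≡sum : ∀ n (f : Fin n → Carrier) → Σ[< n ] f ≡ sum f
  Σ[<]≡sum n f = foldr-tabulate _+_ 0# n id f

  Π[<]≡prod : ∀ n (f : Fin n → Carrier) → Π[< n ] f ≡ prod f
  Π[<]≡prod n f = foldr-tabulate _*_ 1# n id f

  ∑-zero : ∀ {n} {f : Fin n → Carrier} → (∀ i → f i ≈ 0#) → sum f ≈ 0#
  ∑-zero {n} f≈0 = trans (sum-cong-≋ f≈0) (sum-replicate-zero n)

  ∑-single : ∀ {n} (f : Fin n → Carrier) i → (∀ j → j ≢ i → f j ≈ 0#) → sum f ≈ f i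
  ∑-single {suc n} f i others≈0 = begin
    sum f                                      ≈⟨ sum-remove {i = i} f ⟩
    f i + sum (Vector.removeAt f i)            ≈⟨ +-congˡ (∑-zero (λ j → others≈0 _ (FP.punchInᵢ≢i i j))) ⟩
    f i + 0#                                   ≈⟨ +-identityʳ (f i) ⟩
    f i                                        ∎

  ∑-δ : ∀ {n} (i : Fin n) (g : Fin n → Carrier) → sum (λ b → δ i b * g b) ≈ g i
  ∑-δ i g = trans (∑-single _ i vanish) diagonal
    where
    vanish : ∀ b → b ≢ i → δ i b * g b ≈ 0#
    vanish b b≢i = trans (*-congʳ (reflexive (≡.cong ι (δℕ-≢ (b≢i ∘ ≡.sym))))) (zeroˡ (g b))
    diagonal : δ i i * g i ≈ g i
    diagonal = trans (*-congʳ (trans (reflexive (≡.cong ι (δℕ-refl i))) ι-1)) (*-identityˡ (g i))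

  Σℕ : ℕ → (ℕ → Carrier) → Carrier
  Σℕ n f = ∑[ i < n ] f (toℕ i)

  Σℕ-cong : ∀ n {f g : ℕ → Carrier} → (∀ l → l < n → f l ≈ g l) → Σℕ n f ≈ Σℕ n g
  Σℕ-cong n f≈g = sum-cong-≋ (λ i → f≈g (toℕ i) (FP.toℕ<n i))

  Σℕ-scale : ∀ n x (f : ℕ → Carrier) → x * Σℕ n f ≈ Σℕ n (λ l → x * f l)
  Σℕ-scale n x f = *-distribˡ-sum {n} x (f ∘ toℕ)

  Σℕ-+ : ∀ n (f g : ℕ → Carrier) → Σℕ n (λ l → f l + g l) ≈ Σℕ n f + Σℕ n g
  Σℕ-+ n f g = ∑-distrib-+ {n} (f ∘ toℕ) (g ∘ toℕ)

  Σℕ-last : ∀ n (f : ℕ → Carrier) → Σℕ (suc n) f ≈ Σℕ n f + f n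
  Σℕ-last n f = trans (sum-init-last {n} (f ∘ toℕ))
    (+-cong (sum-cong-≋ {n} (λ i → reflexive (≡.cong f (FP.toℕ-inject₁ i))))
            (reflexive (≡.cong f (FP.toℕ-fromℕ n))))

  Σℕ-single : ∀ n (f : ℕ → Carrier) {l₀} → l₀ < n → (∀ l → l < n → l ≢ l₀ → f l ≈ 0#) → Σℕ n f ≈ f l₀
  Σℕ-single n f {l₀} l₀<n others≈0 = begin
    Σℕ n f                        ≈⟨ ∑-single (f ∘ toℕ) i₀ vanish ⟩
    f (toℕ i₀)                    ≡⟨ ≡.cong f (FP.toℕ-fromℕ< l₀<n) ⟩
    f l₀                          ∎
    where
    i₀ = F.fromℕ< l₀<n
    vanish : ∀ i → i ≢ i₀ → f (toℕ i) ≈ 0#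
    vanish i i≢i₀ = others≈0 (toℕ i) (FP.toℕ<n i)
      (λ e → i≢i₀ (FP.toℕ-injective (≡.trans e (≡.sym (FP.toℕ-fromℕ< l₀<n)))))

  listSum : ∀ {A : Set} → List A → (A → Carrier) → Carrier
  listSum xs h = List.foldr (λ x acc → h x + acc) 0# xs

  listSum-cong : ∀ {A : Set} (xs : List A) {f g : A → Carrier} → (∀ x → f x ≈ g x) → listSum xs f ≈ listSum xs g
  listSum-cong []       f≈g = refl
  listSum-cong (x ∷ xs) f≈g = +-cong (f≈g x) (listSum-cong xs f≈g)

  listSum-zero : ∀ {A : Set} (xs : List A) {f : A → Carrier} → (∀ x → f x ≈ 0#) → listSum xs f ≈ 0#
  listSum-zero []       f≈0 = refl
  listSum-zero (x ∷ xs) f≈0 = trans (+-cong (f≈0 x) (listSum-zero xs f≈0)) (+-identityˡ 0#)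

  listSum-scale : ∀ {A : Set} (xs : List A) a (f : A → Carrier) → listSum xs (λ x → a * f x) ≈ a * listSum xs f
  listSum-scale []       a f = sym (zeroʳ a)
  listSum-scale (x ∷ xs) a f = trans (+-congˡ (listSum-scale xs a f)) (sym (distribˡ a _ _))

  listSum-++ : ∀ {A : Set} (xs ys : List A) (f : A → Carrier) → listSum (xs ++ ys) f ≈ listSum xs f + listSum ys f
  listSum-++ []       ys f = sym (+-identityˡ _)
  listSum-++ (x ∷ xs) ys f = trans (+-congˡ (listSum-++ xs ys f)) (sym (+-assoc _ _ _))

  listSum-filter : ∀ {A : Set} {p} {P : A → Set p} (P? : ∀ x → Dec (P x)) (xs : List A) (f : A → Carrier) →
    listSum (List.filter P? xs) f ≈ listSum xs (λ x → if does (P? x) then f x else 0#)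
  listSum-filter P? []       f = refl
  listSum-filter P? (x ∷ xs) f with does (P? x)
  ... | true  = +-congˡ (listSum-filter P? xs f)
  ... | false = trans (listSum-filter P? xs f) (sym (+-identityˡ _))

  listSum-map : ∀ {A B : Set} (g : A → B) (xs : List A) (f : B → Carrier) → listSum (List.map g xs) f ≡ listSum xs (f ∘ g)
  listSum-map g []       f = ≡.refl
  listSum-map g (x ∷ xs) f = ≡.cong (f (g x) +_) (listSum-map g xs f)

  listSum-concatMap : ∀ {A B : Set} (g : A → List B) (xs : List A) (f : B → Carrier) →
    listSum (List.concatMap g xs) f ≈ listSum xs (λ x → listSum (g x) f)
  listSum-concatMap g []       f = refl
  listSum-concatMap g (x ∷ xs) f = trans (listSum-++ (g x) _ f) (+-congˡ (listSum-concatMap g xs f))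

  listSum-allFin : ∀ n (f : Fin n → Carrier) → listSum (List.allFin n) f ≡ sum f
  listSum-allFin n f = foldr-tabulate _+_ 0# n id f

  -- The partial permanent of the rows A using only columns outside U,
  -- defined by expansion along the first row.
  perAvoiding : ∀ m {N} → (Fin N → Bool) → (Fin m → Fin N → Carrier) → Carrier
  perAvoiding zero    U A = 1#
  perAvoiding (suc m) U A = sum λ y → if U y then 0# else A F.zero y * perAvoiding m (mark U y) (A ∘ F.suc)

  perAvoiding-enumerates : ∀ m {N} (U : Fin N → Bool) (A : Fin m → Fin N → Carrier) →
    listSum (allFuns m N) (λ f → if fresh U f then prod (λ x → A x (f x)) else 0#) ≈ perAvoiding m U A
  perAvoiding-enumerates zero    U A = +-identityʳ 1#
  perAvoiding-enumerates (suc m) {N} U A =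
    trans (listSum-concatMap _ (List.allFin N) _)
      (trans (listSum-cong (List.allFin N) (λ y → reflexive (listSum-map _ (allFuns m N) _)))
        (trans (reflexive (listSum-allFin N _)) (sum-cong-≋ first-column)))
    where
    first-column : ∀ y →
      listSum (allFuns m N) (λ f → if not (U y) ∧ fresh (mark U y) f then A F.zero y * prod (λ x → A (F.suc x) (f x)) else 0#)
        ≈ (if U y then 0# else A F.zero y * perAvoiding m (mark U y) (A ∘ F.suc))
    first-column y with U y
    ... | true  = listSum-zero (allFuns m N) (λ _ → refl)
    ... | false = trans (listSum-cong (allFuns m N) (λ f → if-scale (fresh (mark U y) f)))
                        (trans (listSum-scale (allFuns m N) _ _) (*-congˡ (perAvoiding-enumerates m (mark U y) (A ∘ F.suc))))
      where
      if-scale : ∀ b {a p} → (if b then a * p else 0#) ≈ a * (if b then p else 0#)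
      if-scale true  = refl
      if-scale false = sym (zeroʳ _)

  per≈perAvoiding : ∀ {N} (A : Matrix N) → per A ≈ perAvoiding N (λ _ → false) A
  per≈perAvoiding {N} A =
    trans (listSum-filter injective? (allFuns N N) _)
      (trans (listSum-cong (allFuns N N) summand) (perAvoiding-enumerates N _ A))
    where
    summand : ∀ σ → (if does (injective? σ) then Π[< N ] (λ i → A i (σ i)) else 0#)
                    ≈ (if fresh (λ _ → false) σ then prod (λ i → A i (σ i)) else 0#)
    summand σ = reflexive (≡.cong₂ (λ b p → if b then p else 0#) (injective?≡fresh σ) (Π[<]≡prod N _))

  -- perMult ws c is the permanent of the matrix with rows ws, written as
  -- functions of the column type, having c b equal columns of type b:
  -- the first row may use any of the c b columns of type b.
  perMult : ∀ {n} → List (Fin n → Carrier) → Capacity n → Carrier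
  perMult []       c = 1#
  perMult (w ∷ ws) c = sum λ b → w b * (ι (c b) * perMult ws (use c b 1))

  perMult-cong : ∀ {n} (ws : List (Fin n → Carrier)) {c c′ : Capacity n} → (∀ b → c b ≡ c′ b) →
    perMult ws c ≈ perMult ws c′
  perMult-cong []       c≗c′ = refl
  perMult-cong (w ∷ ws) c≗c′ =
    sum-cong-≋ λ b → *-congˡ (*-cong (reflexive (≡.cong ι (c≗c′ b))) (perMult-cong ws (use-cong c≗c′ b 1)))

  ∑-by-type : ∀ {N n} (β : Fin N → Fin n) (U : Fin N → Bool) (G : Fin n → Carrier) →
    sum (λ y → if U y then 0# else G (β y)) ≈ sum (λ b → ι (available β U b) * G b)
  ∑-by-type {N} {n} β U G = sym (begin
    sum (λ b → ι (available β U b) * G b)                     ≈⟨ sum-cong-≋ (λ b → *-congʳ (ι-sum (count b))) ⟩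
    sum (λ b → sum (λ y → ι (count b y)) * G b)               ≈⟨ sum-cong-≋ (λ b → *-distribʳ-sum (G b) (ι ∘ count b)) ⟩
    sum (λ b → sum (λ y → ι (count b y) * G b))               ≈⟨ ∑-comm (λ b y → ι (count b y) * G b) ⟩
    sum (λ y → sum (λ b → ι (count b y) * G b))               ≈⟨ sum-cong-≋ column ⟩
    sum (λ y → if U y then 0# else G (β y))                   ∎)
    where
    count : Fin n → Fin N → ℕ
    count b y = if U y then 0 else δℕ (β y) b
    column : ∀ y → sum (λ b → ι (count b y) * G b) ≈ (if U y then 0# else G (β y))
    column y with U y
    ... | true  = ∑-zero (λ b → zeroˡ (G b))
    ... | false = ∑-δ (β y) G

  perAvoiding≈perMult : ∀ m {N n} (β : Fin N → Fin n) (U : Fin N → Bool)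
    (A : Fin m → Fin N → Carrier) (W : Fin m → Fin n → Carrier) → (∀ x y → A x y ≈ W x (β y)) →
    perAvoiding m U A ≈ perMult (List.tabulate W) (available β U)
  perAvoiding≈perMult zero    β U A W A≈W = refl
  perAvoiding≈perMult (suc m) β U A W A≈W = begin
    sum (λ y → if U y then 0# else A F.zero y * perAvoiding m (mark U y) (A ∘ F.suc))
      ≈⟨ sum-cong-≋ first-column ⟩
    sum (λ y → if U y then 0# else G (β y))
      ≈⟨ ∑-by-type β U G ⟩
    sum (λ b → ι (available β U b) * G b)
      ≈⟨ sum-cong-≋ (λ b → x∙yz≈y∙xz (ι (available β U b)) (W F.zero b) _) ⟩
    perMult (List.tabulate W) (available β U) ∎
    where
    G : _ → Carrier
    G b = W F.zero b * perMult (List.tabulate (W ∘ F.suc)) (use (available β U) b 1)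
    first-column : ∀ y → (if U y then 0# else A F.zero y * perAvoiding m (mark U y) (A ∘ F.suc))
                         ≈ (if U y then 0# else G (β y))
    first-column y with U y in U[y]
    ... | true  = refl
    ... | false = *-cong (A≈W F.zero y)
      (trans (perAvoiding≈perMult m β (mark U y) (A ∘ F.suc) (W ∘ F.suc) (A≈W ∘ F.suc))
             (perMult-cong (List.tabulate (W ∘ F.suc)) (available-mark β U y U[y])))

  ⊗J-entry : ∀ {n} k (A : Matrix n) x y → (A ⊗ J k) x y ≡ A (F.quotient k x) (F.quotient k y) * 1#
  ⊗J-entry {n} k A x y with F.remQuot {n} k x | F.remQuot {n} k y
  ... | i , p | j , q = ≡.refl

  per-⊗J : ∀ n k (A : Matrix n) → per (A ⊗ J k) ≈ perMult (repeatRows k n (λ i b → A i b * 1#)) (λ _ → k)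
  per-⊗J n k A = begin
    per (A ⊗ J k)
      ≈⟨ per≈perAvoiding (A ⊗ J k) ⟩
    perAvoiding (n ℕ.* k) none (A ⊗ J k)
      ≈⟨ perAvoiding≈perMult (n ℕ.* k) (F.quotient k) none (A ⊗ J k) (row ∘ F.quotient k)
                             (λ x y → reflexive (⊗J-entry k A x y)) ⟩
    perMult (List.tabulate (row ∘ F.quotient k)) (available (F.quotient k) none)
      ≡⟨ ≡.cong (λ ws → perMult ws (available (F.quotient k) none)) (tabulate-quotient k n row) ⟩
    perMult (repeatRows k n row) (available (F.quotient k) none)
      ≈⟨ perMult-cong (repeatRows k n row) (available-quotient k n) ⟩
    perMult (repeatRows k n row) (λ _ → k) ∎
    where
    none : Fin (n ℕ.* k) → Bool
    none _ = false
    row : Fin n → Fin n → Carrier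
    row i b = A i b * 1#

  pascal : ∀ k (g : ℕ → Carrier) → Σℕ (suc (suc k)) (λ l → ι (suc k C l) * g l)
    ≈ Σℕ (suc k) (λ l → ι (k C l) * g l) + Σℕ (suc k) (λ l → ι (k C l) * g (suc l))
  pascal k g = begin
    ι 1 * g 0 + Σℕ (suc k) (λ l → ι (suc k C suc l) * g (suc l))
      ≈⟨ +-congˡ (trans (Σℕ-cong (suc k) (λ l _ → split l))
                         (Σℕ-+ (suc k) (λ l → ι (k C l) * g (suc l)) (λ l → ι (k C suc l) * g (suc l)))) ⟩
    ι 1 * g 0 + (shifted + Σℕ (suc k) (λ l → ι (k C suc l) * g (suc l)))
      ≈⟨ +-congˡ (+-congˡ (trans (Σℕ-last k (λ l → ι (k C suc l) * g (suc l)))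
                                 (trans (+-congˡ top-vanishes) (+-identityʳ _)))) ⟩
    ι 1 * g 0 + (shifted + Σℕ k (λ l → ι (k C suc l) * g (suc l)))
      ≈⟨ x+[y+z]≈[x+z]+y _ _ _ ⟩
    (ι 1 * g 0 + Σℕ k (λ l → ι (k C suc l) * g (suc l))) + shifted ∎
    where
    shifted : Carrier
    shifted = Σℕ (suc k) (λ l → ι (k C l) * g (suc l))
    split : ∀ l → ι (suc k C suc l) * g (suc l) ≈ ι (k C l) * g (suc l) + ι (k C suc l) * g (suc l)
    split l = trans (*-congʳ (trans (reflexive (≡.cong ι (≡.sym (nCk+nC[k+1]≡[n+1]C[k+1] k l)))) (ι-+ (k C l) (k C suc l))))
                    (distribʳ _ _ _)
    top-vanishes : ι (k C suc k) * g (suc k) ≈ 0#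
    top-vanishes = trans (*-congʳ (reflexive (≡.cong ι (k>n⇒nCk≡0 (ℕP.n<1+n k))))) (zeroˡ _)

  module TwoTermRows (x y : Carrier) where

    -- The weight x^(k-l) y^l of a block of k rows, l of which use their y-entry.
    mono : ℕ → ℕ → Carrier
    mono k l = x ^ (k ∸ l) * y ^ l

    expand : ∀ {n} (i j : Fin n) (w : Fin n → Carrier) → (∀ b → w b ≈ x * δ i b + y * δ j b) →
      ∀ ws c → perMult (w ∷ ws) c ≈ x * (ι (c i) * perMult ws (use c i 1)) + y * (ι (c j) * perMult ws (use c j 1))
    expand i j w w≈ ws c = begin
      sum (λ b → w b * H b)
        ≈⟨ sum-cong-≋ (λ b → trans (*-congʳ (w≈ b))
                                   (trans (distribʳ _ _ _) (+-cong (xy∙z≈y∙xz _ _ _) (xy∙z≈y∙xz _ _ _)))) ⟩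
      sum (λ b → δ i b * (x * H b) + δ j b * (y * H b))
        ≈⟨ ∑-distrib-+ (λ b → δ i b * (x * H b)) (λ b → δ j b * (y * H b)) ⟩
      sum (λ b → δ i b * (x * H b)) + sum (λ b → δ j b * (y * H b))
        ≈⟨ +-cong (∑-δ i (λ b → x * H b)) (∑-δ j (λ b → y * H b)) ⟩
      x * H i + y * H j ∎
      where
      H : _ → Carrier
      H b = ι (c b) * perMult ws (use c b 1)

    module Placements {n} {i j : Fin n} (i≢j : i ≢ j) (rest : List (Fin n → Carrier)) where

      -- The number of ways (weighted by the rest) to send s further rows to
      -- columns of type i and t to columns of type j, and then the rows rest.
      placed : Capacity n → ℕ → ℕ → Carrier
      placed c s t = ι (c i ↓ s) * (ι (c j ↓ t) * perMult rest (use (use c i s) j t))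

      placed-i : ∀ c s t → ι (c i) * placed (use c i 1) s t ≈ placed c (suc s) t
      placed-i c s t = begin
        ι (c i) * placed (use c i 1) s t
          ≈⟨ *-congˡ (*-cong (reflexive (≡.cong (λ a → ι (a ↓ s)) (use-at c i 1)))
                             (*-cong (reflexive (≡.cong (λ a → ι (a ↓ t)) (use-away c 1 i≢j)))
                                     (perMult-cong rest (use-cong (use-use c i 1 s) j t)))) ⟩
        ι (c i) * (ι ((c i ∸ 1) ↓ s) * rest-value)
          ≈⟨ sym (*-assoc _ _ _) ⟩
        ι (c i) * ι ((c i ∸ 1) ↓ s) * rest-value
          ≈⟨ *-congʳ (sym (ι-* (c i) _)) ⟩
        placed c (suc s) t ∎
        where
        rest-value : Carrier
        rest-value = ι (c j ↓ t) * perMult rest (use (use c i (suc s)) j t)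

      placed-j : ∀ c s t → ι (c j) * placed (use c j 1) s t ≈ placed c s (suc t)
      placed-j c s t = begin
        ι (c j) * placed (use c j 1) s t
          ≈⟨ *-congˡ (*-cong (reflexive (≡.cong (λ a → ι (a ↓ s)) (use-away c 1 (i≢j ∘ ≡.sym))))
                             (*-congˡ (perMult-cong rest capacity))) ⟩
        ι (c j) * (ι (c i ↓ s) * (ι (use c j 1 j ↓ t) * perMult rest (use (use c i s) j (suc t))))
          ≈⟨ x∙yz≈y∙xz _ _ _ ⟩
        ι (c i ↓ s) * (ι (c j) * (ι (use c j 1 j ↓ t) * perMult rest (use (use c i s) j (suc t))))
          ≈⟨ *-congˡ (trans (sym (*-assoc _ _ _)) (*-congʳ (trans (sym (ι-* (c j) _))
                       (reflexive (≡.cong (λ a → ι (c j ℕ.* (a ↓ t))) (use-at c j 1)))))) ⟩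
        placed c s (suc t) ∎
        where
        capacity : ∀ b → use (use (use c j 1) i s) j t b ≡ use (use c i s) j (suc t) b
        capacity b = ≡.trans (use-cong (use-comm c j 1 i s) j t b) (use-use (use c i s) j 1 t b)

      -- The l-th term of the binomial sum of a block of k rows: l of them use
      -- a column of type j, the other k - l one of type i.
      blockTerm : ℕ → Capacity n → ℕ → Carrier
      blockTerm k c l = ι (k C l) * (mono k l * placed c (k ∸ l) l)

      block : ∀ k (w : Fin n → Carrier) → (∀ b → w b ≈ x * δ i b + y * δ j b) → ∀ c →
        perMult (replicate k w ++ rest) c ≈ Σℕ (suc k) (blockTerm k c)
      block zero w w≈ c = sym (begin
        ι 1 * (1# * 1# * (ι 1 * (ι 1 * perMult rest (use (use c i 0) j 0)))) + 0#
          ≈⟨ +-identityʳ _ ⟩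
        ι 1 * (1# * 1# * (ι 1 * (ι 1 * perMult rest (use (use c i 0) j 0))))
          ≈⟨ *-cong ι-1 (*-cong (*-identityˡ 1#) (*-cong ι-1 (*-cong ι-1 (perMult-cong rest unused)))) ⟩
        1# * (1# * (1# * (1# * perMult rest c)))
          ≈⟨ trans (*-identityˡ _) (trans (*-identityˡ _) (trans (*-identityˡ _) (*-identityˡ _))) ⟩
        perMult rest c ∎)
        where
        unused : ∀ b → use (use c i 0) j 0 b ≡ c b
        unused b = ≡.trans (use-none (use c i 0) j b) (use-none c i b)
      block (suc k) w w≈ c = begin
        perMult (w ∷ (replicate k w ++ rest)) c
          ≈⟨ expand i j w w≈ (replicate k w ++ rest) c ⟩
        x * (ι (c i) * perMult (replicate k w ++ rest) (use c i 1)) + y * (ι (c j) * perMult (replicate k w ++ rest) (use c j 1))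
          ≈⟨ +-cong (*-congˡ (*-congˡ (block k w w≈ _))) (*-congˡ (*-congˡ (block k w w≈ _))) ⟩
        x * (ι (c i) * previous (use c i 1)) + y * (ι (c j) * previous (use c j 1))
          ≈⟨ +-cong (scale-in x (ι (c i)) (use c i 1) via-i) (scale-in y (ι (c j)) (use c j 1) via-j) ⟩
        Σℕ (suc k) (λ l → ι (k C l) * g l) + Σℕ (suc k) (λ l → ι (k C l) * g (suc l))
          ≈⟨ pascal k g ⟨
        Σℕ (suc (suc k)) (λ l → ι (suc k C l) * g l) ∎
        where
        previous : Capacity n → Carrier
        previous c′ = Σℕ (suc k) (blockTerm k c′)
        scale-in : ∀ z a c′ {h : ℕ → Carrier} → (∀ l → l < suc k → z * (a * blockTerm k c′ l) ≈ h l) →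
          z * (a * previous c′) ≈ Σℕ (suc k) h
        scale-in z a c′ {h} eq = begin
          z * (a * previous c′)                         ≈⟨ *-congˡ (Σℕ-scale (suc k) a (blockTerm k c′)) ⟩
          z * Σℕ (suc k) (λ l → a * blockTerm k c′ l)   ≈⟨ Σℕ-scale (suc k) z (λ l → a * blockTerm k c′ l) ⟩
          Σℕ (suc k) (λ l → z * (a * blockTerm k c′ l)) ≈⟨ Σℕ-cong (suc k) eq ⟩
          Σℕ (suc k) h                                  ∎
        g : ℕ → Carrier
        g l = mono (suc k) l * placed c (suc k ∸ l) l
        via-i : ∀ l → l < suc k → x * (ι (c i) * (ι (k C l) * (mono k l * placed (use c i 1) (k ∸ l) l))) ≈ ι (k C l) * g l
        via-i l (s≤s l≤k) = begin
          x * (ι (c i) * (ι (k C l) * (x ^ (k ∸ l) * y ^ l * placed (use c i 1) (k ∸ l) l)))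
            ≈⟨ solve 6 (λ X A C P Q Z → (X ·′ (A ·′ (C ·′ ((P ·′ Q) ·′ Z)))) ⊜ (C ·′ (((X ·′ P) ·′ Q) ·′ (A ·′ Z)))) refl
                 x (ι (c i)) (ι (k C l)) (x ^ (k ∸ l)) (y ^ l) _ ⟩
          ι (k C l) * (x ^ suc (k ∸ l) * y ^ l * (ι (c i) * placed (use c i 1) (k ∸ l) l))
            ≈⟨ *-congˡ (*-congˡ (placed-i c (k ∸ l) l)) ⟩
          ι (k C l) * (x ^ suc (k ∸ l) * y ^ l * placed c (suc (k ∸ l)) l)
            ≡⟨ ≡.cong (λ s → ι (k C l) * (x ^ s * y ^ l * placed c s l)) (ℕP.+-∸-assoc 1 l≤k) ⟨
          ι (k C l) * g l ∎
        via-j : ∀ l → l < suc k →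
          y * (ι (c j) * (ι (k C l) * (mono k l * placed (use c j 1) (k ∸ l) l))) ≈ ι (k C l) * g (suc l)
        via-j l _ = begin
          y * (ι (c j) * (ι (k C l) * (x ^ (k ∸ l) * y ^ l * placed (use c j 1) (k ∸ l) l)))
            ≈⟨ solve 6 (λ Y A C P Q Z → (Y ·′ (A ·′ (C ·′ ((P ·′ Q) ·′ Z)))) ⊜ (C ·′ ((P ·′ (Y ·′ Q)) ·′ (A ·′ Z)))) refl
                 y (ι (c j)) (ι (k C l)) (x ^ (k ∸ l)) (y ^ l) _ ⟩
          ι (k C l) * (x ^ (k ∸ l) * y ^ suc l * (ι (c j) * placed (use c j 1) (k ∸ l) l))
            ≈⟨ *-congˡ (*-congˡ (placed-j c (k ∸ l) l)) ⟩
          ι (k C l) * g (suc l) ∎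

      placed-vanishesᵢ : ∀ c {s} t → c i < s → placed c s t ≈ 0#
      placed-vanishesᵢ c t lt = trans (*-congʳ (reflexive (≡.cong ι (↓-vanishes lt)))) (zeroˡ _)

      placed-vanishesⱼ : ∀ c s {t} → c j < t → placed c s t ≈ 0#
      placed-vanishesⱼ c s lt =
        trans (*-congˡ (trans (*-congʳ (reflexive (≡.cong ι (↓-vanishes lt)))) (zeroˡ _))) (zeroʳ _)

      placed-vanishes-rest : ∀ c s t → perMult rest (use (use c i s) j t) ≈ 0# → placed c s t ≈ 0#
      placed-vanishes-rest c s t rest≈0 = trans (*-congˡ (trans (*-congˡ rest≈0) (zeroʳ _))) (zeroʳ _)

      -- If c i = k - p then at least p of the k rows must use type j; if in
      -- addition all terms with l > q vanish (q ≤ p), only l = q can survive,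
      -- and it does only when p = q.
      block-pinned : ∀ k c {p q} → c i ≡ k ∸ p → q ≤ p → p ≤ k →
        (∀ l → q < l → l ≤ k → placed c (k ∸ l) l ≈ 0#) →
        (p ≡ q → Σℕ (suc k) (blockTerm k c) ≈ blockTerm k c q) × (q < p → Σℕ (suc k) (blockTerm k c) ≈ 0#)
      block-pinned k c {p} {q} c[i] q≤p p≤k above = (λ { ≡.refl → only-q }) , (λ q<p → trans only-q (below q q<p))
        where
        term-vanishes : ∀ {l} → placed c (k ∸ l) l ≈ 0# → blockTerm k c l ≈ 0#
        term-vanishes placed≈0 = trans (*-congˡ (trans (*-congˡ placed≈0) (zeroʳ _))) (zeroʳ _)
        below : ∀ l → l < p → blockTerm k c l ≈ 0#
        below l l<p = term-vanishes (placed-vanishesᵢ c l (≡.subst (_< k ∸ l) (≡.sym c[i]) (ℕP.∸-monoʳ-< l<p p≤k)))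
        others : ∀ l → l < suc k → l ≢ q → blockTerm k c l ≈ 0#
        others l (s≤s l≤k) l≢q with l ℕ.<? p
        ... | yes l<p = below l l<p
        ... | no  l≮p = term-vanishes (above l q<l l≤k)
          where
          q<l : q < l
          q<l = ℕP.≤∧≢⇒< (ℕP.≤-trans q≤p (ℕP.≮⇒≥ l≮p)) (l≢q ∘ ≡.sym)
        only-q : Σℕ (suc k) (blockTerm k c) ≈ blockTerm k c q
        only-q = Σℕ-single (suc k) (blockTerm k c) (s≤s (ℕP.≤-trans q≤p p≤k)) others

  module Chains (x y : Carrier) (k : ℕ) where
    open TwoTermRows x y

    -- T l = C(k,l) x^(k-l) y^l, and X l = T l · k! is the contribution of one
    -- block in which exactly l rows use their y-entry.
    T X : ℕ → Carrier
    T l = ι (k C l) * mono k l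
    X l = T l * ι (k !)

    -- The contribution of the last block of a chain.
    End : ℕ → Carrier
    End l = T l * (ι ((k ∸ l) !) * ι (l !))

    ι-↓-split : ∀ {a b} → b ≤ a → ι (a ↓ b) * ι ((a ∸ b) !) ≈ ι (a !)
    ι-↓-split {a} {b} b≤a = trans (sym (ι-* (a ↓ b) ((a ∸ b) !))) (reflexive (≡.cong ι (↓-split b≤a)))

    -- Blocks t = 0, …, r of k rows x·e(σ t) + y·e(next σ z t) along the path
    -- σ 0, …, σ r, z of distinct column types.  If c (σ 0) = k - p, every
    -- inner type has capacity k and c z = q ≤ p, then the permanent vanishes
    -- unless p = q, and then every block uses its y-entry exactly q times.
    chain : ∀ {n} r (σ : Fin (suc r) → Fin n) (z : Fin n) → Injective _≡_ _≡_ σ → (∀ t → σ t ≢ z) →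
      (W : Fin (suc r) → Fin n → Carrier) → (∀ t b → W t b ≈ x * δ (σ t) b + y * δ (next σ z t) b) →
      ∀ c {p q} → c (σ F.zero) ≡ k ∸ p → (∀ t → c (σ (F.suc t)) ≡ k) → c z ≡ q → q ≤ p → p ≤ k →
      (p ≡ q → perMult (repeatRows k (suc r) W) c ≈ X q ^ r * End q) × (q < p → perMult (repeatRows k (suc r) W) c ≈ 0#)
    chain zero σ z σ-inj σ≢z W W≈ c {p} {q} c[σ0] _ c[z] q≤p p≤k =
      (λ p≡q → trans sum≈ (trans (proj₁ pinned p≡q) (last-value p≡q))) , (λ q<p → trans sum≈ (proj₂ pinned q<p))
      where
      open Placements (σ≢z F.zero) []
      sum≈ : perMult (repeatRows k 1 W) c ≈ Σℕ (suc k) (blockTerm k c)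
      sum≈ = block k (W F.zero) (W≈ F.zero) c
      pinned : (p ≡ q → Σℕ (suc k) (blockTerm k c) ≈ blockTerm k c q) × (q < p → Σℕ (suc k) (blockTerm k c) ≈ 0#)
      pinned = block-pinned k c c[σ0] q≤p p≤k
        (λ l q<l _ → placed-vanishesⱼ c (k ∸ l) (≡.subst (_< l) (≡.sym c[z]) q<l))
      last-value : p ≡ q → blockTerm k c q ≈ 1# * End q
      last-value ≡.refl = begin
        ι (k C q) * (mono k q * (ι (c (σ F.zero) ↓ (k ∸ q)) * (ι (c z ↓ q) * 1#)))
          ≡⟨ ≡.cong₂ (λ a b → ι (k C q) * (mono k q * (ι (a ↓ (k ∸ q)) * (ι (b ↓ q) * 1#)))) c[σ0] c[z] ⟩
        ι (k C q) * (mono k q * (ι ((k ∸ q) ↓ (k ∸ q)) * (ι (q ↓ q) * 1#)))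
          ≡⟨ ≡.cong₂ (λ a b → ι (k C q) * (mono k q * (ι a * (ι b * 1#)))) (↓-self (k ∸ q)) (↓-self q) ⟩
        ι (k C q) * (mono k q * (ι ((k ∸ q) !) * (ι (q !) * 1#)))
          ≈⟨ solve 4 (λ C M A B → (C ·′ (M ·′ (A ·′ (B ·′ ε′)))) ⊜ (ε′ ·′ ((C ·′ M) ·′ (A ·′ B)))) refl _ _ _ _ ⟩
        1# * End q ∎
    chain {n} (suc r) σ z σ-inj σ≢z W W≈ c {p} {q} c[σ0] c[inner] c[z] q≤p p≤k =
      (λ p≡q → trans sum≈ (trans (proj₁ pinned p≡q) (chain-value p≡q))) , (λ q<p → trans sum≈ (proj₂ pinned q<p))
      where
      σ0 σ1 : Fin n
      σ0 = σ F.zero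
      σ1 = σ (F.suc F.zero)
      σ0≢σ1 : σ0 ≢ σ1
      σ0≢σ1 eq = contradiction (σ-inj eq) λ ()
      rest : List (Fin n → Carrier)
      rest = repeatRows k (suc r) (W ∘ F.suc)
      open Placements σ0≢σ1 rest
      sum≈ : perMult (repeatRows k (suc (suc r)) W) c ≈ Σℕ (suc k) (blockTerm k c)
      sum≈ = block k (W F.zero) (W≈ F.zero) c
      -- After the first block with l rows on σ 1, the rest is a shorter chain.
      rest-chain : ∀ l → q ≤ l → l ≤ k →
        (l ≡ q → perMult rest (use (use c σ0 (k ∸ l)) σ1 l) ≈ X q ^ r * End q) ×
        (q < l → perMult rest (use (use c σ0 (k ∸ l)) σ1 l) ≈ 0#)
      rest-chain l q≤l l≤k =
        chain r (σ ∘ F.suc) z (FP.suc-injective ∘ σ-inj) (σ≢z ∘ F.suc) (W ∘ F.suc) (W≈ ∘ F.suc)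
          (use (use c σ0 (k ∸ l)) σ1 l) c′[σ1] c′[inner] c′[z] q≤l l≤k
        where
        c′[σ1] : use (use c σ0 (k ∸ l)) σ1 l σ1 ≡ k ∸ l
        c′[σ1] = ≡.trans (use-at (use c σ0 (k ∸ l)) σ1 l)
                         (≡.cong (_∸ l) (≡.trans (use-away c (k ∸ l) σ0≢σ1) (c[inner] F.zero)))
        c′[inner] : ∀ t → use (use c σ0 (k ∸ l)) σ1 l (σ (F.suc (F.suc t))) ≡ k
        c′[inner] t = ≡.trans (use-away (use c σ0 (k ∸ l)) l (λ eq → contradiction (σ-inj eq) λ ()))
                     (≡.trans (use-away c (k ∸ l) (λ eq → contradiction (σ-inj eq) λ ())) (c[inner] (F.suc t)))
        c′[z] : use (use c σ0 (k ∸ l)) σ1 l z ≡ q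
        c′[z] = ≡.trans (use-away (use c σ0 (k ∸ l)) l (σ≢z (F.suc F.zero)))
                        (≡.trans (use-away c (k ∸ l) (σ≢z F.zero)) c[z])
      pinned : (p ≡ q → Σℕ (suc k) (blockTerm k c) ≈ blockTerm k c q) × (q < p → Σℕ (suc k) (blockTerm k c) ≈ 0#)
      pinned = block-pinned k c c[σ0] q≤p p≤k
        (λ l q<l l≤k → placed-vanishes-rest c (k ∸ l) l (proj₂ (rest-chain l (ℕP.<⇒≤ q<l) l≤k) q<l))
      chain-value : p ≡ q → blockTerm k c q ≈ X q ^ suc r * End q
      chain-value ≡.refl = begin
        ι (k C q) * (mono k q * (ι (c σ0 ↓ (k ∸ q)) * (ι (c σ1 ↓ q) * perMult rest (use (use c σ0 (k ∸ q)) σ1 q))))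
          ≈⟨ *-congˡ (*-congˡ (*-cong (reflexive (≡.cong ι (≡.trans (≡.cong (_↓ (k ∸ q)) c[σ0]) (↓-self (k ∸ q)))))
                                      (*-cong (reflexive (≡.cong (λ a → ι (a ↓ q)) (c[inner] F.zero)))
                                              (proj₁ (rest-chain q ℕP.≤-refl p≤k) ≡.refl)))) ⟩
        ι (k C q) * (mono k q * (ι ((k ∸ q) !) * (ι (k ↓ q) * (X q ^ r * End q))))
          ≈⟨ solve 5 (λ C M A B Y → (C ·′ (M ·′ (A ·′ (B ·′ Y)))) ⊜ (((C ·′ M) ·′ (B ·′ A)) ·′ Y)) refl _ _ _ _ _ ⟩
        T q * (ι (k ↓ q) * ι ((k ∸ q) !)) * (X q ^ r * End q)
          ≈⟨ *-congʳ (*-congˡ (ι-↓-split p≤k)) ⟩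
        X q * (X q ^ r * End q)
          ≈⟨ sym (*-assoc _ _ _) ⟩
        X q ^ suc r * End q ∎

  single-type : ∀ m (w : Fin 1 → Carrier) (c : Capacity 1) →
    perMult (replicate m w) c ≈ w F.zero ^ m * ι (c F.zero ↓ m)
  single-type zero    w c = sym (trans (*-identityˡ _) ι-1)
  single-type (suc m) w c = begin
    w F.zero * (ι (c F.zero) * perMult (replicate m w) (use c F.zero 1)) + 0#
      ≈⟨ +-identityʳ _ ⟩
    w F.zero * (ι (c F.zero) * perMult (replicate m w) (use c F.zero 1))
      ≈⟨ *-congˡ (*-congˡ (single-type m w (use c F.zero 1))) ⟩
    w F.zero * (ι (c F.zero) * (w F.zero ^ m * ι ((c F.zero ∸ 1) ↓ m)))
      ≈⟨ solve 4 (λ W A P B → (W ·′ (A ·′ (P ·′ B))) ⊜ ((W ·′ P) ·′ (A ·′ B))) refl _ _ _ _ ⟩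
    w F.zero ^ suc m * (ι (c F.zero) * ι ((c F.zero ∸ 1) ↓ m))
      ≈⟨ *-congˡ (sym (ι-* (c F.zero) _)) ⟩
    w F.zero ^ suc m * ι (c F.zero ↓ suc m) ∎

  module Circulant (a₀ a₁ : Carrier) (k : ℕ) where
    open TwoTermRows a₀ a₁
    open Chains a₀ a₁ k

    A : ∀ n → Matrix n
    A n = (a₀ · I n) ⊕ (a₁ · P n)

    V : ∀ n → Fin n → Fin n → Carrier
    V n i b = A n i b * 1#

    I-δ : ∀ n (i b : Fin n) → I n i b ≈ δ i b
    I-δ n i b with i FP.≟ b
    ... | yes ≡.refl = sym (trans (reflexive (≡.cong ι (δℕ-refl i))) ι-1)
    ... | no  i≢b    = reflexive (≡.cong ι (≡.sym (δℕ-≢ i≢b)))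

    P-δ : ∀ m (i j : Fin (suc m)) → toℕ j ≡ (toℕ i ℕ.+ 1) ℕ.% suc m → ∀ b → P (suc m) i b ≈ δ j b
    P-δ m i j j≡ b with toℕ b ℕ.≟ ((toℕ i ℕ.+ 1) ℕ.% suc m)
    ... | yes b≡ = sym (trans (reflexive (≡.cong ι (≡.trans (≡.cong (δℕ j) b≡j) (δℕ-refl j)))) ι-1)
      where
      b≡j : b ≡ j
      b≡j = FP.toℕ-injective (≡.trans b≡ (≡.sym j≡))
    ... | no  b≢ = reflexive (≡.cong ι (≡.sym (δℕ-≢ λ j≡b → b≢ (≡.trans (≡.cong toℕ (≡.sym j≡b)) j≡))))

    V-δ : ∀ m (i j : Fin (suc m)) → toℕ j ≡ (toℕ i ℕ.+ 1) ℕ.% suc m →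
      ∀ b → V (suc m) i b ≈ a₀ * δ i b + a₁ * δ j b
    V-δ m i j j≡ b = trans (*-identityʳ _) (+-cong (*-congˡ (I-δ (suc m) i b)) (*-congˡ (P-δ m i j j≡ b)))

    rhs≈ : ∀ n → ι (k !) ^ n * Σ[< suc k ] (λ l → ι (k C toℕ l) ^ n * mono k (toℕ l) ^ n)
                 ≈ Σℕ (suc k) (λ l → X l ^ n)
    rhs≈ n = begin
      ι (k !) ^ n * Σ[< suc k ] (λ l → ι (k C toℕ l) ^ n * mono k (toℕ l) ^ n)
        ≡⟨ ≡.cong (ι (k !) ^ n *_) (Σ[<]≡sum (suc k) _) ⟩
      ι (k !) ^ n * Σℕ (suc k) (λ l → ι (k C l) ^ n * mono k l ^ n)
        ≈⟨ Σℕ-scale (suc k) (ι (k !) ^ n) (λ l → ι (k C l) ^ n * mono k l ^ n) ⟩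
      Σℕ (suc k) (λ l → ι (k !) ^ n * (ι (k C l) ^ n * mono k l ^ n))
        ≈⟨ Σℕ-cong (suc k) (λ l _ → sym (trans (^-distrib-* (T l) (ι (k !)) n)
                                         (trans (*-congʳ (^-distrib-* (ι (k C l)) (mono k l) n)) (*-comm _ _)))) ⟩
      Σℕ (suc k) (λ l → X l ^ n) ∎

    theorem-single : per (A 1 ⊗ J k) ≈ Σℕ (suc k) (λ l → X l ^ 1)
    theorem-single = begin
      per (A 1 ⊗ J k)
        ≈⟨ per-⊗J 1 k (A 1) ⟩
      perMult (replicate k (V 1 F.zero) ++ []) (λ _ → k)
        ≡⟨ ≡.cong (λ ws → perMult ws (λ _ → k)) (ListP.++-identityʳ (replicate k (V 1 F.zero))) ⟩
      perMult (replicate k (V 1 F.zero)) (λ _ → k)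
        ≈⟨ single-type k (V 1 F.zero) (λ _ → k) ⟩
      V 1 F.zero F.zero ^ k * ι (k ↓ k)
        ≈⟨ *-cong (^-congˡ k entry) (reflexive (≡.cong ι (↓-self k))) ⟩
      (a₁ + a₀) ^ k * ι (k !)
        ≈⟨ *-congʳ (Binomial.theorem k a₁ a₀) ⟩
      Σℕ (suc k) (λ l → (k C l) ⨯ (a₁ ^ l * a₀ ^ (k ∸ l))) * ι (k !)
        ≈⟨ *-distribʳ-sum {suc k} (ι (k !)) (λ l → (k C toℕ l) ⨯ (a₁ ^ toℕ l * a₀ ^ (k ∸ toℕ l))) ⟩
      Σℕ (suc k) (λ l → (k C l) ⨯ (a₁ ^ l * a₀ ^ (k ∸ l)) * ι (k !))
        ≈⟨ Σℕ-cong (suc k) (λ l _ → term l) ⟩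
      Σℕ (suc k) (λ l → X l ^ 1) ∎
      where
      entry : V 1 F.zero F.zero ≈ a₁ + a₀
      entry = trans (V-δ 0 F.zero F.zero ≡.refl F.zero)
                    (trans (+-cong (trans (*-congˡ ι-1) (*-identityʳ a₀)) (trans (*-congˡ ι-1) (*-identityʳ a₁)))
                           (+-comm a₀ a₁))
      term : ∀ l → (k C l) ⨯ (a₁ ^ l * a₀ ^ (k ∸ l)) * ι (k !) ≈ X l ^ 1
      term l = begin
        (k C l) ⨯ (a₁ ^ l * a₀ ^ (k ∸ l)) * ι (k !)
          ≈⟨ *-congʳ (×-congʳ (k C l) (sym (*-identityˡ _))) ⟩
        (k C l) ⨯ (1# * (a₁ ^ l * a₀ ^ (k ∸ l))) * ι (k !)
          ≈⟨ *-congʳ (sym (×-assoc-* (k C l) 1# _)) ⟩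
        ι (k C l) * (a₁ ^ l * a₀ ^ (k ∸ l)) * ι (k !)
          ≈⟨ *-congʳ (*-congˡ (*-comm _ _)) ⟩
        X l
          ≈⟨ *-identityʳ (X l) ⟨
        X l ^ 1 ∎

    theorem-cycle : ∀ r → per (A (suc (suc r)) ⊗ J k) ≈ Σℕ (suc k) (λ l → X l ^ suc (suc r))
    theorem-cycle r = begin
      per (A n ⊗ J k)
        ≈⟨ per-⊗J n k (A n) ⟩
      perMult (replicate k (V n F.zero) ++ rest) (λ _ → k)
        ≈⟨ block k (V n F.zero) (V-δ (suc r) F.zero (F.suc F.zero) ≡.refl) (λ _ → k) ⟩
      Σℕ (suc k) (blockTerm k (λ _ → k))
        ≈⟨ Σℕ-cong (suc k) (λ l l<k+1 → balanced l (ℕP.≤-pred l<k+1)) ⟩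
      Σℕ (suc k) (λ l → X l ^ n) ∎
      where
      n : ℕ
      n = suc (suc r)
      rest : List (Fin n → Carrier)
      rest = repeatRows k (suc r) (V n ∘ F.suc)
      open Placements {i = F.zero} {j = F.suc F.zero} (λ ()) rest
      balanced : ∀ l → l ≤ k → blockTerm k (λ _ → k) l ≈ X l ^ n
      balanced l l≤k = begin
        ι (k C l) * (mono k l * (ι (k ↓ (k ∸ l)) * (ι (k ↓ l) * perMult rest c′)))
          ≈⟨ *-congˡ (*-congˡ (*-congˡ (*-congˡ chain-value))) ⟩
        ι (k C l) * (mono k l * (ι (k ↓ (k ∸ l)) * (ι (k ↓ l) * (X l ^ r * End l))))
          ≈⟨ solve 7 (λ C M A B Y E F → (C ·′ (M ·′ (A ·′ (B ·′ (Y ·′ ((C ·′ M) ·′ (E ·′ F)))))))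
                                        ⊜ (((C ·′ M) ·′ (B ·′ E)) ·′ (((C ·′ M) ·′ (A ·′ F)) ·′ Y))) refl _ _ _ _ _ _ _ ⟩
        T l * (ι (k ↓ l) * ι ((k ∸ l) !)) * (T l * (ι (k ↓ (k ∸ l)) * ι (l !)) * X l ^ r)
          ≈⟨ *-cong (*-congˡ (ι-↓-split l≤k)) (*-congʳ (*-congˡ complementary)) ⟩
        X l ^ n ∎
        where
        c′ : Capacity n
        c′ = use (use (λ _ → k) F.zero (k ∸ l)) (F.suc F.zero) l
        -- The rows 1, …, n-1 form a chain along the path 1, …, n-1, 0.
        chain-value : perMult rest c′ ≈ X l ^ r * End l
        chain-value = proj₁ (chain r F.suc F.zero FP.suc-injective (λ t ()) (V n ∘ F.suc)
          (λ t → V-δ (suc r) (F.suc t) (next F.suc F.zero t) (cycle-successor r t))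
          c′ (use-at {n} (λ _ → k) (F.suc F.zero) l) (λ _ → ≡.refl)
          (≡.trans (use-at {n} (λ _ → k) F.zero (k ∸ l)) (ℕP.m∸[m∸n]≡n l≤k)) ℕP.≤-refl l≤k) ≡.refl
        complementary : ι (k ↓ (k ∸ l)) * ι (l !) ≈ ι (k !)
        complementary = trans (*-congˡ (reflexive (≡.cong (λ a → ι (a !)) (≡.sym (ℕP.m∸[m∸n]≡n l≤k)))))
                              (ι-↓-split (ℕP.m∸n≤m k l))

-- Both for n = 1 and for n ≥ 2 the permanent equals Σₗ (X l)ⁿ, which is the
-- right-hand side.
theorem4 : ∀ {c ℓ : Level} (R : CommutativeRing c ℓ) (a₀ a₁ : CommutativeRing.Carrier R) (k : ℕ) → k ≥ 1 → (n : ℕ) → n ≥ 1 →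
    let open Ops R in
    per (((a₀ · I n) ⊕ (a₁ · P n)) ⊗ J k)
      ≈ (ι (k !) ^ n) * (Σ[< suc k ] (λ l → (ι (k C toℕ l) ^ n) * (((a₀ ^ (k ∸ toℕ l)) * (a₁ ^ toℕ l)) ^ n)))
theorem4 R a₀ a₁ k _ (suc zero)    _ = trans theorem-single (sym (rhs≈ 1))
  where
  open CommutativeRing R using (trans; sym)
  open Permanents R
  open Circulant a₀ a₁ k
theorem4 R a₀ a₁ k _ (suc (suc r)) _ = trans (theorem-cycle r) (sym (rhs≈ (suc (suc r))))
  where
  open CommutativeRing R using (trans; sym)
  open Permanents R
  open Circulant a₀ a₁ k
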